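{- Let $n \ge 2$ and $n-1 \le k \le 2n-3$, let $d \ge 3$ divide $n$ but not divide $k$, and let $\omega$ be a primitive $d$-th root of unity. Then $c(n,k;\omega) = 0$, where $$c(n,k;q) = \frac{1}{[n-1]_q}{3n-3 \brack n+k}_q {k-1 \brack n-2}_q$$ (a polynomial in $q$).
   Context: $[m]_q = 1+q+\cdots+q^{m-1}$, $[m]!_q = [m]_q[m-1]_q\cdots[1]_q$, and ${a \brack b}_q = \frac{[a]!_q}{[b]!_q[a-b]!_q}$ for $0\le b\le a$, and ${a \brack b}_q=0$ otherwise. -}

module Defs where

open import Level using (Level)
open import Data.Nat using (ℕ; zero; suc)
open import Data.Sum using (_⊎_)
open import Data.Empty using (⊥)
open import Relation.Binary.PropositionalEquality using (_≡_)
open import Relation.Nullary using (¬_)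
open import Algebra.Bundles using (CommutativeRing)

module _ {c ℓ : Level} (R : CommutativeRing c ℓ) where
  open CommutativeRing R

  pow : Carrier → ℕ → Carrier
  pow x zero    = 1#
  pow x (suc m) = x * pow x m

  natR : ℕ → Carrier
  natR zero    = 0#
  natR (suc m) = 1# + natR m

  qInt : Carrier → ℕ → Carrier
  qInt q zero    = 0#
  qInt q (suc m) = 1# + q * qInt q m

  -- Gaussian binomial [a choose b]_q (the polynomial in q, evaluated at q),
  -- via q-Pascal: [a+1, b+1] = [a, b] + q^(b+1) [a, b+1];  = 0 when b > a.
  qBinom : Carrier → ℕ → ℕ → Carrier
  qBinom q a       zero    = 1#
  qBinom q zero    (suc b) = 0#
  qBinom q (suc a) (suc b) = qBinom q a b + pow q (suc b) * qBinom q a (suc b)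

  IsIntegralDomain : Set (c Level.⊔ ℓ)
  IsIntegralDomain = (¬ (1# ≈ 0#)) × ((x y : Carrier) → x * y ≈ 0# → (x ≈ 0#) ⊎ (y ≈ 0#))
    where open import Data.Product using (_×_)

  CharZero : Set ℓ
  CharZero = (m : ℕ) → natR m ≈ 0# → m ≡ 0

  IsPrimitiveRoot : ℕ → Carrier → Set ℓ
  IsPrimitiveRoot d ω = (pow ω d ≈ 1#) × ((j : ℕ) → 0 Data.Nat.< j → j Data.Nat.< d → ¬ (pow ω j ≈ 1#))
    where open import Data.Product using (_×_)

  -- "c(n,k;ω) = x", i.e. x · [n-1]_ω = [3n-3 choose n+k]_ω · [k-1 choose n-2]_ω
  -- (c is defined by the paper as this quotient; [n-1]_ω ≠ 0 in the theorem's setting)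
  IsCValue : ℕ → ℕ → Carrier → Carrier → Set ℓ
  IsCValue n k ω x =
    x * qInt ω (n Data.Nat.∸ 1) ≈
      qBinom ω (3 Data.Nat.* n Data.Nat.∸ 3) (n Data.Nat.+ k) * qBinom ω (k Data.Nat.∸ 1) (n Data.Nat.∸ 2)

-- The proof rests on the q-Lucas theorem: at a primitive d-th root of unity,
--   [αd+s, βd+t]_ω = C(α,β) · [s,t]_ω      for 0 ≤ s, t < d,
-- where C(α,β) is the ordinary binomial coefficient.  Its only non-formal
-- input is that [d, t]_ω = 0 for 0 < t < d, which follows from the dual
-- q-Pascal rule: ω^t fixes [d,t]_ω, and ω^t ≠ 1.
--
-- Write d = f + 3, n = md and k = κd + r with 0 < r < d.  Then
-- 3n-3 = (3m-1)d + f, n+k = (m+κ)d + r, k-1 = κd + (r-1), n-2 = (m-1)d + (f+1),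
-- so by q-Lucas the first factor of the numerator of c carries [f, r]_ω, which
-- vanishes when r > f, and the second carries [r-1, f+1]_ω, which vanishes
-- when r ≤ f.  Since [n-1]_ω ≠ 0 (as ω^(d-1) ≠ 1) and R is a domain, c = 0.

module Submission where

open import Defs
open import Level using (Level)
open import Data.Nat using (ℕ; _≤_; _∸_; _*_; _+_)
open import Data.Nat.Divisibility using (_∣_; _∤_)
open import Algebra.Bundles using (CommutativeRing)

open import Data.Nat using (zero; suc; _<_; z≤n; s≤s)
import Data.Nat.Properties as ℕ
open import Data.Nat.DivMod using (_%_; _/_; m≡m%n+[m/n]*n; m%n<n)
open import Data.Nat.Divisibility using (divides; m%n≡0⇒n∣m)
import Data.Nat.Tactic.RingSolver as ℕ-Solver
open import Data.Product using (proj₁; proj₂)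
open import Data.Sum using (inj₁; inj₂)
open import Data.Empty using (⊥-elim)
open import Function using (_∘_)
open import Data.Maybe using (nothing)
open import Relation.Nullary using (¬_; yes; no)
open import Relation.Binary.PropositionalEquality as ≡ using (_≡_)
open import Tactic.RingSolver using (solve-∀)
open import Tactic.RingSolver.Core.AlmostCommutativeRing
  using (AlmostCommutativeRing; fromCommutativeRing)

module RingIdentities {c ℓ : Level} (R : CommutativeRing c ℓ) where
  private
    solverRing : AlmostCommutativeRing c ℓ
    solverRing = fromCommutativeRing R (λ _ → nothing)
    module S = AlmostCommutativeRing solverRing
  open S using (_≈_) renaming (_+_ to _+ᵣ_; _*_ to _*ᵣ_)

  factor-out : ∀ C x w y → C *ᵣ x +ᵣ w *ᵣ (C *ᵣ y) ≈ C *ᵣ (x +ᵣ w *ᵣ y)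
  factor-out = solve-∀ solverRing

  shift-left : ∀ q u z → q *ᵣ (u +ᵣ q *ᵣ z) +ᵣ u ≈ q *ᵣ (q *ᵣ z +ᵣ u) +ᵣ u
  shift-left = solve-∀ solverRing

  shift-right : ∀ q u z p → q *ᵣ (z +ᵣ p) +ᵣ u ≈ (u +ᵣ q *ᵣ z) +ᵣ q *ᵣ p
  shift-right = solve-∀ solverRing

  dual-regroup₁ : ∀ q p u v w → (q *ᵣ p) *ᵣ (v +ᵣ (q *ᵣ p) *ᵣ w) +ᵣ (u +ᵣ p *ᵣ v)
                              ≈ (q *ᵣ p) *ᵣ ((q *ᵣ p) *ᵣ w +ᵣ v) +ᵣ (p *ᵣ v +ᵣ u)
  dual-regroup₁ = solve-∀ solverRing

  dual-regroup₂ : ∀ q p r u v w → (q *ᵣ p) *ᵣ (w +ᵣ r *ᵣ v) +ᵣ (v +ᵣ (q *ᵣ r) *ᵣ u)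
                                ≈ (v +ᵣ (q *ᵣ p) *ᵣ w) +ᵣ (q *ᵣ r) *ᵣ (u +ᵣ p *ᵣ v)
  dual-regroup₂ = solve-∀ solverRing

module DomainFacts {c ℓ : Level} (R : CommutativeRing c ℓ) (domain : IsIntegralDomain R) where
  open CommutativeRing R renaming (_+_ to _+ᵣ_; _*_ to _*ᵣ_)
  open import Algebra.Properties.Group +-group using (x∙y⁻¹≈ε⇒x≈y)
  open import Algebra.Properties.Ring ring using (-1*x≈-x)
  open import Relation.Binary.Reasoning.Setoid setoid

  cancel-nonzero : ∀ {x y} → x *ᵣ y ≈ 0# → ¬ (y ≈ 0#) → x ≈ 0#
  cancel-nonzero {x} {y} xy≈0 y≉0 with proj₂ domain x y xy≈0
  ... | inj₁ x≈0 = x≈0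
  ... | inj₂ y≈0 = ⊥-elim (y≉0 y≈0)

  fixed-point-zero : ∀ {x y} → x *ᵣ y ≈ y → ¬ (x ≈ 1#) → y ≈ 0#
  fixed-point-zero {x} {y} xy≈y x≉1 with proj₂ domain (x +ᵣ - 1#) y [x-1]y≈0
    where
    [x-1]y≈0 : (x +ᵣ - 1#) *ᵣ y ≈ 0#
    [x-1]y≈0 = begin
      (x +ᵣ - 1#) *ᵣ y       ≈⟨ distribʳ y x (- 1#) ⟩
      x *ᵣ y +ᵣ - 1# *ᵣ y    ≈⟨ +-cong xy≈y (-1*x≈-x y) ⟩
      y +ᵣ - y               ≈⟨ -‿inverseʳ y ⟩
      0#                     ∎
  ... | inj₁ x-1≈0 = ⊥-elim (x≉1 (x∙y⁻¹≈ε⇒x≈y x 1# x-1≈0))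
  ... | inj₂ y≈0   = y≈0

module GaussianBinomials {c ℓ : Level} (R : CommutativeRing c ℓ) where
  open CommutativeRing R renaming (_+_ to _+ᵣ_; _*_ to _*ᵣ_) hiding (zero)
  open RingIdentities R using (shift-left; shift-right; dual-regroup₁; dual-regroup₂)
  open import Relation.Binary.Reasoning.Setoid setoid

  infixr 8 _^_
  _^_ : Carrier → ℕ → Carrier
  _^_ = pow R

  qbin : Carrier → ℕ → ℕ → Carrier
  qbin = qBinom R

  qint : Carrier → ℕ → Carrier
  qint = qInt R

  pow-+ : ∀ x m n → x ^ (m + n) ≈ x ^ m *ᵣ x ^ n
  pow-+ x zero    n = sym (*-identityˡ _)
  pow-+ x (suc m) n = trans (*-congˡ (pow-+ x m n)) (sym (*-assoc _ _ _))

  qbin-vanish : ∀ q a b → a < b → qbin q a b ≈ 0#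
  qbin-vanish q zero    (suc b) _           = refl
  qbin-vanish q (suc a) (suc b) (s≤s a<b) = begin
    qbin q a b +ᵣ q ^ suc b *ᵣ qbin q a (suc b)
      ≈⟨ +-cong (qbin-vanish q a b a<b) (*-congˡ (qbin-vanish q a (suc b) (ℕ.m<n⇒m<1+n a<b))) ⟩
    0# +ᵣ q ^ suc b *ᵣ 0#  ≈⟨ +-identityˡ _ ⟩
    q ^ suc b *ᵣ 0#        ≈⟨ zeroʳ _ ⟩
    0#                     ∎

  qbin-diag : ∀ q a → qbin q a a ≈ 1#
  qbin-diag q zero    = refl
  qbin-diag q (suc a) = begin
    qbin q a a +ᵣ q ^ suc a *ᵣ qbin q a (suc a)
      ≈⟨ +-cong (qbin-diag q a) (*-congˡ (qbin-vanish q a (suc a) (ℕ.n<1+n a))) ⟩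
    1# +ᵣ q ^ suc a *ᵣ 0#  ≈⟨ +-congˡ (zeroʳ _) ⟩
    1# +ᵣ 0#               ≈⟨ +-identityʳ _ ⟩
    1#                     ∎

  qbin-one : ∀ q a → qbin q a 1 ≈ qint q a
  qbin-one q zero    = refl
  qbin-one q (suc a) = +-congˡ (*-cong (*-identityʳ q) (qbin-one q a))

  -- q[m]_q + 1 = [m]_q + q^m, both being [m+1]_q.
  qint-shift : ∀ q m → q *ᵣ qint q m +ᵣ 1# ≈ qint q m +ᵣ q ^ m
  qint-shift q zero    = +-congʳ (zeroʳ q)
  qint-shift q (suc m) = begin
    q *ᵣ (1# +ᵣ q *ᵣ qint q m) +ᵣ 1#  ≈⟨ shift-left q 1# (qint q m) ⟩
    q *ᵣ (q *ᵣ qint q m +ᵣ 1#) +ᵣ 1#  ≈⟨ +-congʳ (*-congˡ (qint-shift q m)) ⟩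
    q *ᵣ (qint q m +ᵣ q ^ m) +ᵣ 1#    ≈⟨ shift-right q 1# (qint q m) (q ^ m) ⟩
    (1# +ᵣ q *ᵣ qint q m) +ᵣ q *ᵣ q ^ m ∎

  -- Dual q-Pascal rule: the defining recursion [a+1,b+1] = [a,b] + q^(b+1)[a,b+1]
  -- agrees with [a+1,b+1] = [a,b+1] + q^(a-b)[a,b].
  DualPascal : Carrier → ℕ → ℕ → Set ℓ
  DualPascal q a b =
    q ^ suc b *ᵣ qbin q a (suc b) +ᵣ qbin q a b ≈ qbin q a (suc b) +ᵣ q ^ (a ∸ b) *ᵣ qbin q a b

  dualPascal-base : ∀ q a → DualPascal q a 0
  dualPascal-base q a = begin
    q ^ 1 *ᵣ qbin q a 1 +ᵣ 1#  ≈⟨ +-congʳ (*-cong (*-identityʳ q) (qbin-one q a)) ⟩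
    q *ᵣ qint q a +ᵣ 1#        ≈⟨ qint-shift q a ⟩
    qint q a +ᵣ q ^ a          ≈⟨ +-cong (sym (qbin-one q a)) (sym (*-identityʳ _)) ⟩
    qbin q a 1 +ᵣ q ^ a *ᵣ 1#  ∎

  -- For a ≤ b both sides collapse to [a,b]_q.
  dualPascal-degenerate : ∀ q a b → a ≤ b → DualPascal q a b
  dualPascal-degenerate q a b a≤b = begin
    q ^ suc b *ᵣ qbin q a (suc b) +ᵣ qbin q a b  ≈⟨ +-congʳ (trans (*-congˡ top≈0) (zeroʳ _)) ⟩
    0# +ᵣ qbin q a b                             ≈⟨ +-congˡ (sym (*-identityˡ _)) ⟩
    0# +ᵣ q ^ 0 *ᵣ qbin q a b                    ≡⟨ ≡.cong (λ i → 0# +ᵣ q ^ i *ᵣ qbin q a b) (≡.sym (ℕ.m≤n⇒m∸n≡0 a≤b)) ⟩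
    0# +ᵣ q ^ (a ∸ b) *ᵣ qbin q a b              ≈⟨ +-congʳ (sym top≈0) ⟩
    qbin q a (suc b) +ᵣ q ^ (a ∸ b) *ᵣ qbin q a b ∎
    where
    top≈0 : qbin q a (suc b) ≈ 0#
    top≈0 = qbin-vanish q a (suc b) (s≤s a≤b)

  dualPascal-step : ∀ q a b → b < a → DualPascal q a (suc b) → DualPascal q a b →
                    DualPascal q (suc a) (suc b)
  dualPascal-step q a b b<a next this = begin
    (q *ᵣ p) *ᵣ (v +ᵣ (q *ᵣ p) *ᵣ w) +ᵣ (u +ᵣ p *ᵣ v)  ≈⟨ dual-regroup₁ q p u v w ⟩
    (q *ᵣ p) *ᵣ ((q *ᵣ p) *ᵣ w +ᵣ v) +ᵣ (p *ᵣ v +ᵣ u)  ≈⟨ +-cong (*-congˡ next) this ⟩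
    (q *ᵣ p) *ᵣ (w +ᵣ r *ᵣ v) +ᵣ (v +ᵣ q ^ (a ∸ b) *ᵣ u)
      ≡⟨ ≡.cong (λ i → (q *ᵣ p) *ᵣ (w +ᵣ r *ᵣ v) +ᵣ (v +ᵣ q ^ i *ᵣ u)) a∸b≡1+a∸[1+b] ⟩
    (q *ᵣ p) *ᵣ (w +ᵣ r *ᵣ v) +ᵣ (v +ᵣ (q *ᵣ r) *ᵣ u)  ≈⟨ dual-regroup₂ q p r u v w ⟩
    (v +ᵣ (q *ᵣ p) *ᵣ w) +ᵣ (q *ᵣ r) *ᵣ (u +ᵣ p *ᵣ v)
      ≡⟨ ≡.cong (λ i → (v +ᵣ (q *ᵣ p) *ᵣ w) +ᵣ q ^ i *ᵣ (u +ᵣ p *ᵣ v)) (≡.sym a∸b≡1+a∸[1+b]) ⟩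
    (v +ᵣ (q *ᵣ p) *ᵣ w) +ᵣ q ^ (a ∸ b) *ᵣ (u +ᵣ p *ᵣ v) ∎
    where
    p = q ^ suc b
    r = q ^ (a ∸ suc b)
    u = qbin q a b
    v = qbin q a (suc b)
    w = qbin q a (suc (suc b))
    a∸b≡1+a∸[1+b] : a ∸ b ≡ suc (a ∸ suc b)
    a∸b≡1+a∸[1+b] = ℕ.+-∸-assoc 1 b<a

  dualPascal : ∀ q a b → DualPascal q a b
  dualPascal q a       zero    = dualPascal-base q a
  dualPascal q zero    (suc b) = dualPascal-degenerate q zero (suc b) z≤n
  dualPascal q (suc a) (suc b) with b ℕ.<? a
  ... | yes b<a = dualPascal-step q a b b<a (dualPascal q a (suc b)) (dualPascal q a b)
  ... | no  b≮a = dualPascal-degenerate q (suc a) (suc b) (s≤s (ℕ.≮⇒≥ b≮a))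

  binomR : ℕ → ℕ → Carrier
  binomR zero    zero    = 1#
  binomR zero    (suc _) = 0#
  binomR (suc _) zero    = 1#
  binomR (suc α) (suc β) = binomR α β +ᵣ binomR α (suc β)

  binomR-zero : ∀ α → binomR α 0 ≡ 1#
  binomR-zero zero    = ≡.refl
  binomR-zero (suc α) = ≡.refl

module AtRootOfUnity {c ℓ : Level} (R : CommutativeRing c ℓ) (domain : IsIntegralDomain R)
                     {e : ℕ} (ω : CommutativeRing.Carrier R) (prim : IsPrimitiveRoot R (suc e) ω) where
  open CommutativeRing R renaming (_+_ to _+ᵣ_; _*_ to _*ᵣ_) hiding (zero)
  open GaussianBinomials R
  open DomainFacts R domain using (fixed-point-zero)
  open RingIdentities R using (factor-out)
  open import Relation.Binary.Reasoning.Setoid setoid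

  d : ℕ
  d = suc e

  ω^d≈1 : ω ^ d ≈ 1#
  ω^d≈1 = proj₁ prim

  ω^j≉1 : ∀ j → 0 < j → j < d → ¬ (ω ^ j ≈ 1#)
  ω^j≉1 = proj₂ prim

  pow-periodic : ∀ β t → ω ^ (β * d + t) ≈ ω ^ t
  pow-periodic zero    t = refl
  pow-periodic (suc β) t = begin
    ω ^ ((d + β * d) + t)    ≡⟨ ≡.cong (ω ^_) (ℕ.+-assoc d (β * d) t) ⟩
    ω ^ (d + (β * d + t))    ≈⟨ pow-+ ω d (β * d + t) ⟩
    ω ^ d *ᵣ ω ^ (β * d + t) ≈⟨ *-cong ω^d≈1 (pow-periodic β t) ⟩
    1# *ᵣ ω ^ t              ≈⟨ *-identityˡ _ ⟩
    ω ^ t                    ∎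

  -- [d,t+1]_ω = 0 for t + 1 < d: by the dual q-Pascal rule ω^(t+1) fixes it,
  -- because ω^(t+1) · ω^(d-1-t) = ω^d = 1.
  qbin-root-vanish : ∀ t → t < e → qbin ω d (suc t) ≈ 0#
  qbin-root-vanish t t<e = fixed-point-zero fixed (ω^j≉1 (suc t) (s≤s z≤n) (s≤s t<e))
    where
    p = ω ^ suc t
    x = qbin ω e t
    y = qbin ω e (suc t)
    complementary : p *ᵣ ω ^ (e ∸ t) ≈ 1#
    complementary = begin
      p *ᵣ ω ^ (e ∸ t)     ≈⟨ sym (pow-+ ω (suc t) (e ∸ t)) ⟩
      ω ^ suc (t + (e ∸ t)) ≡⟨ ≡.cong (λ i → ω ^ suc i) (ℕ.m+[n∸m]≡n (ℕ.<⇒≤ t<e)) ⟩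
      ω ^ d                ≈⟨ ω^d≈1 ⟩
      1#                   ∎
    fixed : p *ᵣ (x +ᵣ p *ᵣ y) ≈ x +ᵣ p *ᵣ y
    fixed = begin
      p *ᵣ (x +ᵣ p *ᵣ y)                ≈⟨ *-congˡ (+-comm x (p *ᵣ y)) ⟩
      p *ᵣ (p *ᵣ y +ᵣ x)                ≈⟨ *-congˡ (dualPascal ω e t) ⟩
      p *ᵣ (y +ᵣ ω ^ (e ∸ t) *ᵣ x)      ≈⟨ trans (distribˡ p y _) (+-congˡ (sym (*-assoc p _ x))) ⟩
      p *ᵣ y +ᵣ (p *ᵣ ω ^ (e ∸ t)) *ᵣ x ≈⟨ +-congˡ (trans (*-congʳ complementary) (*-identityˡ x)) ⟩
      p *ᵣ y +ᵣ x                       ≈⟨ +-comm (p *ᵣ y) x ⟩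
      x +ᵣ p *ᵣ y                       ∎

  pascal-mod : ∀ a β t → qbin ω (suc a) (suc (β * d + t))
                         ≈ qbin ω a (β * d + t) +ᵣ ω ^ suc t *ᵣ qbin ω a (suc (β * d + t))
  pascal-mod a β t = +-congˡ (*-congʳ (*-congˡ (pow-periodic β t)))

  carry : ∀ β → suc β * d + 0 ≡ suc (β * d + e)
  carry β = ≡.cong suc (≡.trans (ℕ.+-identityʳ (e + β * d)) (ℕ.+-comm e (β * d)))

  qbin-at : ∀ {a a′ b b′} → a ≡ a′ → b ≡ b′ → qbin ω a b ≡ qbin ω a′ b′
  qbin-at = ≡.cong₂ (qbin ω)

  column : ∀ a {b b′} → b ≡ b′ → qbin ω a b ≈ qbin ω a b′
  column a b≡b′ = reflexive (≡.cong (qbin ω a) b≡b′)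

  -- q-Lucas theorem at ω.  Each case applies the defining recursion once and
  -- the induction hypothesis to both terms (the column index βd + t + 1 being
  -- re-expressed in base d).
  qLucas : ∀ α s β t → s < d → t < d → qbin ω (α * d + s) (β * d + t) ≈ binomR α β *ᵣ qbin ω s t
  qLucas α s zero zero _ _ = sym (trans (*-identityʳ _) (reflexive (binomR-zero α)))
  qLucas zero zero zero    (suc t) _ _ = sym (zeroʳ _)
  qLucas zero zero (suc β) t       _ _ = sym (zeroˡ _)
  qLucas α (suc s) β (suc t) s<d t<d = begin
    qbin ω (α * d + suc s) (β * d + suc t)      ≡⟨ qbin-at (ℕ.+-suc (α * d) s) (ℕ.+-suc (β * d) t) ⟩
    qbin ω (suc (α * d + s)) (suc (β * d + t))  ≈⟨ pascal-mod (α * d + s) β t ⟩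
    qbin ω (α * d + s) (β * d + t) +ᵣ ω ^ suc t *ᵣ qbin ω (α * d + s) (suc (β * d + t))
      ≈⟨ +-cong (qLucas α s β t (ℕ.<⇒≤ s<d) (ℕ.<⇒≤ t<d))
                (*-congˡ (trans (column (α * d + s) (≡.sym (ℕ.+-suc (β * d) t))) (qLucas α s β (suc t) (ℕ.<⇒≤ s<d) t<d))) ⟩
    C *ᵣ qbin ω s t +ᵣ ω ^ suc t *ᵣ (C *ᵣ qbin ω s (suc t))
      ≈⟨ factor-out C (qbin ω s t) (ω ^ suc t) (qbin ω s (suc t)) ⟩
    C *ᵣ qbin ω (suc s) (suc t) ∎
    where
    C = binomR α β
  qLucas α (suc s) (suc β) zero (s≤s s<e) _ = begin
    qbin ω (α * d + suc s) (suc β * d + 0)      ≡⟨ qbin-at (ℕ.+-suc (α * d) s) (carry β) ⟩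
    qbin ω (suc (α * d + s)) (suc (β * d + e))  ≈⟨ pascal-mod (α * d + s) β e ⟩
    qbin ω (α * d + s) (β * d + e) +ᵣ ω ^ d *ᵣ qbin ω (α * d + s) (suc (β * d + e))
      ≈⟨ +-cong (qLucas α s β e s<d (ℕ.n<1+n e))
                (*-cong ω^d≈1 (trans (column (α * d + s) (≡.sym (carry β))) (qLucas α s (suc β) 0 s<d (s≤s z≤n)))) ⟩
    binomR α β *ᵣ qbin ω s e +ᵣ 1# *ᵣ (binomR α (suc β) *ᵣ 1#)
      ≈⟨ +-cong (trans (*-congˡ (qbin-vanish ω s e s<e)) (zeroʳ _)) (*-identityˡ _) ⟩
    0# +ᵣ binomR α (suc β) *ᵣ 1#  ≈⟨ +-identityˡ _ ⟩
    binomR α (suc β) *ᵣ 1#        ∎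
    where
    s<d : s < d
    s<d = ℕ.m<n⇒m<1+n s<e
  qLucas (suc α) zero β (suc t) _ (s≤s t<e) = begin
    qbin ω (suc α * d + 0) (β * d + suc t)      ≡⟨ qbin-at (carry α) (ℕ.+-suc (β * d) t) ⟩
    qbin ω (suc (α * d + e)) (suc (β * d + t))  ≈⟨ pascal-mod (α * d + e) β t ⟩
    qbin ω (α * d + e) (β * d + t) +ᵣ ω ^ suc t *ᵣ qbin ω (α * d + e) (suc (β * d + t))
      ≈⟨ +-cong (qLucas α e β t (ℕ.n<1+n e) (ℕ.m<n⇒m<1+n t<e))
                (*-congˡ (trans (column (α * d + e) (≡.sym (ℕ.+-suc (β * d) t))) (qLucas α e β (suc t) (ℕ.n<1+n e) (s≤s t<e)))) ⟩
    C *ᵣ qbin ω e t +ᵣ ω ^ suc t *ᵣ (C *ᵣ qbin ω e (suc t))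
      ≈⟨ factor-out C (qbin ω e t) (ω ^ suc t) (qbin ω e (suc t)) ⟩
    C *ᵣ qbin ω d (suc t)  ≈⟨ *-congˡ (qbin-root-vanish t t<e) ⟩
    C *ᵣ 0#                ≈⟨ zeroʳ _ ⟩
    0#                     ≈⟨ sym (zeroʳ _) ⟩
    binomR (suc α) β *ᵣ 0# ∎
    where
    C = binomR α β
  qLucas (suc α) zero (suc β) zero _ _ = begin
    qbin ω (suc α * d + 0) (suc β * d + 0)      ≡⟨ qbin-at (carry α) (carry β) ⟩
    qbin ω (suc (α * d + e)) (suc (β * d + e))  ≈⟨ pascal-mod (α * d + e) β e ⟩
    qbin ω (α * d + e) (β * d + e) +ᵣ ω ^ d *ᵣ qbin ω (α * d + e) (suc (β * d + e))
      ≈⟨ +-cong (qLucas α e β e (ℕ.n<1+n e) (ℕ.n<1+n e))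
                (*-cong ω^d≈1 (trans (column (α * d + e) (≡.sym (carry β))) (qLucas α e (suc β) 0 (ℕ.n<1+n e) (s≤s z≤n)))) ⟩
    binomR α β *ᵣ qbin ω e e +ᵣ 1# *ᵣ (binomR α (suc β) *ᵣ 1#)
      ≈⟨ +-cong (*-congˡ (qbin-diag ω e)) (*-identityˡ _) ⟩
    binomR α β *ᵣ 1# +ᵣ binomR α (suc β) *ᵣ 1#  ≈⟨ sym (distribʳ 1# (binomR α β) (binomR α (suc β))) ⟩
    (binomR α β +ᵣ binomR α (suc β)) *ᵣ 1#      ∎

  -- [md - 1]_ω ≠ 0 when d ≥ 2: otherwise ω^(md-1) = 1, i.e. ω^(d-1) = 1.
  qint-root-nonzero : 0 < e → ∀ m → ¬ (qint ω (suc m * d ∸ 1) ≈ 0#)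
  qint-root-nonzero 0<e m [N]≈0 = ω^j≉1 e 0<e (ℕ.n<1+n e) (sym 1≈ω^e)
    where
    N = suc m * d ∸ 1
    1≈ω^e : 1# ≈ ω ^ e
    1≈ω^e = begin
      1#                     ≈⟨ sym (+-identityˡ 1#) ⟩
      0# +ᵣ 1#               ≈⟨ +-congʳ (sym (trans (*-congˡ [N]≈0) (zeroʳ ω))) ⟩
      ω *ᵣ qint ω N +ᵣ 1#    ≈⟨ qint-shift ω N ⟩
      qint ω N +ᵣ ω ^ N      ≈⟨ +-congʳ [N]≈0 ⟩
      0# +ᵣ ω ^ (e + m * d)  ≈⟨ +-identityˡ _ ⟩
      ω ^ (e + m * d)        ≡⟨ ≡.cong (ω ^_) (ℕ.+-comm e (m * d)) ⟩
      ω ^ (m * d + e)        ≈⟨ pow-periodic m e ⟩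
      ω ^ e                  ∎

module Numerator {c ℓ : Level} (R : CommutativeRing c ℓ) (domain : IsIntegralDomain R)
                 {f : ℕ} (ω : CommutativeRing.Carrier R) (prim : IsPrimitiveRoot R (3 + f) ω) where
  open CommutativeRing R renaming (_+_ to _+ᵣ_; _*_ to _*ᵣ_) hiding (zero)
  open GaussianBinomials R
  open AtRootOfUnity R domain ω prim
  open import Relation.Binary.Reasoning.Setoid setoid

  top-digits : ∀ m → 3 * (suc m * d) ∸ 3 ≡ (3 * m + 2) * d + f
  top-digits m = ≡.trans (≡.cong (_∸ 3) (expand f m)) (ℕ.m+n∸n≡m ((3 * m + 2) * (3 + f) + f) 3)
    where
    expand : ∀ f m → 3 * (suc m * (3 + f)) ≡ ((3 * m + 2) * (3 + f) + f) + 3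
    expand = ℕ-Solver.solve-∀

  position-digits : ∀ m κ r → suc m * d + (r + κ * d) ≡ (suc m + κ) * d + r
  position-digits m κ r = regroup f m κ r
    where
    regroup : ∀ f m κ r → suc m * (3 + f) + (r + κ * (3 + f)) ≡ (suc m + κ) * (3 + f) + r
    regroup = ℕ-Solver.solve-∀

  -- If the last digit r of k exceeds f, the first factor carries [f, r]_ω = 0.
  first-factor-vanishes : ∀ m κ r → f < r → r < d →
                          qbin ω (3 * (suc m * d) ∸ 3) (suc m * d + (r + κ * d)) ≈ 0#
  first-factor-vanishes m κ r f<r r<d = begin
    qbin ω (3 * (suc m * d) ∸ 3) (suc m * d + (r + κ * d))  ≡⟨ qbin-at (top-digits m) (position-digits m κ r) ⟩
    qbin ω ((3 * m + 2) * d + f) ((suc m + κ) * d + r)     ≈⟨ qLucas (3 * m + 2) f (suc m + κ) r f<d r<d ⟩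
    binomR (3 * m + 2) (suc m + κ) *ᵣ qbin ω f r          ≈⟨ *-congˡ (qbin-vanish ω f r f<r) ⟩
    binomR (3 * m + 2) (suc m + κ) *ᵣ 0#                  ≈⟨ zeroʳ _ ⟩
    0#                                                    ∎
    where
    f<d : f < d
    f<d = ℕ.m≤n⇒m≤1+n (ℕ.m≤n⇒m≤1+n (ℕ.n<1+n f))

  -- If the last digit r + 1 of k is at most f, the second factor carries [r, f+1]_ω = 0.
  second-factor-vanishes : ∀ m κ r → suc r ≤ f →
                           qbin ω ((suc r + κ * d) ∸ 1) (suc m * d ∸ 2) ≈ 0#
  second-factor-vanishes m κ r r<f = begin
    qbin ω (r + κ * d) (suc f + m * d)     ≡⟨ qbin-at (ℕ.+-comm r (κ * d)) (ℕ.+-comm (suc f) (m * d)) ⟩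
    qbin ω (κ * d + r) (m * d + suc f)     ≈⟨ qLucas κ r m (suc f) r<d (ℕ.m<n⇒m<1+n (ℕ.n<1+n (suc f))) ⟩
    binomR κ m *ᵣ qbin ω r (suc f)         ≈⟨ *-congˡ (qbin-vanish ω r (suc f) (ℕ.m<n⇒m<1+n r<f)) ⟩
    binomR κ m *ᵣ 0#                       ≈⟨ zeroʳ _ ⟩
    0#                                     ∎
    where
    r<d : r < d
    r<d = ℕ.m≤n⇒m≤1+n (ℕ.m≤n⇒m≤1+n (ℕ.m<n⇒m<1+n r<f))

  -- Writing k = r + κd with r = k mod d ≠ 0, one of the two factors vanishes.
  numerator-vanishes : ∀ m k → d ∤ k →
    qbin ω (3 * (suc m * d) ∸ 3) (suc m * d + k) *ᵣ qbin ω (k ∸ 1) (suc m * d ∸ 2) ≈ 0#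
  numerator-vanishes m k d∤k =
    ≡.subst (λ k → qbin ω (3 * (suc m * d) ∸ 3) (suc m * d + k) *ᵣ qbin ω (k ∸ 1) (suc m * d ∸ 2) ≈ 0#)
            (≡.sym (m≡m%n+[m/n]*n k d))
            (by-last-digit (k % d) (m%n<n k d) (d∤k ∘ m%n≡0⇒n∣m k d))
    where
    κ = k / d
    by-last-digit : ∀ r → r < d → ¬ (r ≡ 0) →
      qbin ω (3 * (suc m * d) ∸ 3) (suc m * d + (r + κ * d)) *ᵣ qbin ω ((r + κ * d) ∸ 1) (suc m * d ∸ 2) ≈ 0#
    by-last-digit zero    _   r≢0 = ⊥-elim (r≢0 ≡.refl)
    by-last-digit (suc r) r<d _ with f ℕ.<? suc r
    ... | yes f<r = trans (*-congʳ (first-factor-vanishes m κ (suc r) f<r r<d)) (zeroˡ _)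
    ... | no  f≮r = trans (*-congˡ (second-factor-vanishes m κ r (ℕ.≮⇒≥ f≮r))) (zeroʳ _)

-- x · [n-1]_ω equals the vanishing numerator and [n-1]_ω ≠ 0, so x = 0.
-- The case n = 0 · d is excluded by 2 ≤ n.
mainTheorem9 : {c ℓ : Level} (R : CommutativeRing c ℓ) → IsIntegralDomain R → CharZero R →
    (n k d : ℕ) → 2 ≤ n → n ∸ 1 ≤ k → k ≤ 2 * n ∸ 3 → 3 ≤ d → d ∣ n → d ∤ k →
    (ω : CommutativeRing.Carrier R) → IsPrimitiveRoot R d ω →
    (x : CommutativeRing.Carrier R) → IsCValue R n k ω x → CommutativeRing._≈_ R x (CommutativeRing.0# R)
mainTheorem9 R _ _ _ _ _ () _ _ _ (divides zero ≡.refl) _ _ _ _ _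
mainTheorem9 R domain _ _ k _ _ _ _ (s≤s (s≤s (s≤s _))) (divides (suc m) ≡.refl) d∤k ω prim x x[n-1]≈num =
  cancel-nonzero (trans x[n-1]≈num (numerator-vanishes m k d∤k)) (qint-root-nonzero (s≤s z≤n) m)
  where
  open CommutativeRing R using (trans)
  open DomainFacts R domain using (cancel-nonzero)
  open AtRootOfUnity R domain ω prim using (qint-root-nonzero)
  open Numerator R domain ω prim using (numerator-vanishes)
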